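{- Let $\lambda\in\mathbb{C}_p$ with $\lambda\ne0$ and $|\lambda|_p\le1$ ($p$ an odd prime). For every $n\ge0$ and every odd positive integer $d$, \[ Ch_{n,\lambda}(d)+Ch_{n,\lambda}=2\sum_{a=0}^{d-1}\sum_{m=0}^n(a)_{m,\lambda}\,S_1(n,m)\,(-1)^a. \]
   Context: $(x)_{0,\lambda}=1$, $(x)_{n,\lambda}=x(x-\lambda)\cdots(x-(n-1)\lambda)$ for $n\ge1$, and $(1+\lambda u)^{x/\lambda}=\sum_{m\ge0}(x)_{m,\lambda}u^m/m!$. $S_1(n,m)$ are the signed Stirling numbers of the first kind: $x(x-1)\cdots(x-n+1)=\sum_{m=0}^nS_1(n,m)x^m$. The degenerate Changhee polynomials of the second kind: $\frac{2}{1+(1+\lambda\log(1+t))^{1/\lambda}}(1+\lambda\log(1+t))^{x/\lambda}=\sum_{n\ge0}Ch_{n,\lambda}(x)\frac{t^n}{n!}$, with $Ch_{n,\lambda}=Ch_{n,\lambda}(0)$. -}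

module Defs where

open import Level using (Level)
open import Data.Nat as ℕ using (ℕ; zero; suc; _∸_)
open import Data.Nat.Combinatorics using ()
import Data.Nat.Base as NB
open import Data.Integer as ℤ using (ℤ; +_; -[1+_])
open import Data.List using (List; []; _∷_)
open import Algebra.Bundles using (CommutativeRing)

-- Signed Stirling numbers of the first kind:
-- x(x-1)...(x-n+1) = Σ_m S1 n m x^m, i.e.
-- S1(0,0)=1, S1(0,m+1)=0, S1(n+1,0)=0, S1(n+1,m+1)=S1(n,m) - n*S1(n,m+1).
S1 : ℕ → ℕ → ℤ
S1 zero zero = + 1
S1 zero (suc m) = + 0
S1 (suc n) zero = + 0
S1 (suc n) (suc m) = S1 n m ℤ.- (+ n) ℤ.* S1 n (suc m)

-- Everything below lives in a commutative ring R in which every positive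
-- integer k+1 has an inverse  inv k  (a ℚ-algebra, e.g. ℂ_p).
module QAlg {c ℓ : Level} (R : CommutativeRing c ℓ)
            (inv : ℕ → CommutativeRing.Carrier R) where
  open CommutativeRing R

  ι : ℕ → Carrier
  ι zero = 0#
  ι (suc n) = 1# + ι n

  ιℤ : ℤ → Carrier
  ιℤ (+ n) = ι n
  ιℤ -[1+ n ] = - ι (suc n)

  sgn : ℕ → Carrier
  sgn zero = 1#
  sgn (suc a) = - sgn a

  sumTo : ℕ → (ℕ → Carrier) → Carrier
  sumTo zero f = 0#
  sumTo (suc n) f = sumTo n f + f n

  -- 1/m! = Π_{k<m} inv k
  invFact : ℕ → Carrier
  invFact zero = 1#
  invFact (suc m) = invFact m * inv m

  fallingλ : Carrier → Carrier → ℕ → Carrier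
  fallingλ lam x zero = 1#
  fallingλ lam x (suc m) = fallingλ lam x m * (x - ι m * lam)

  -- formal power series in t, by (ordinary) coefficients: f n = [t^n] f
  Series : Set c
  Series = ℕ → Carrier

  oneS : Series
  oneS zero = 1#
  oneS (suc n) = 0#

  _⊕_ : Series → Series → Series
  (f ⊕ g) n = f n + g n

  scaleS : Carrier → Series → Series
  scaleS a f n = a * f n

  _⊛_ : Series → Series → Series
  (f ⊛ g) n = sumTo (suc n) (λ k → f k * g (n ∸ k))

  powS : Series → ℕ → Series
  powS f zero = oneS
  powS f (suc m) = f ⊛ powS f m

  -- log(1+t) = Σ_{n≥1} (-1)^{n-1} t^n / n
  logS : Series
  logS zero = 0#
  logS (suc n) = sgn n * inv n

  -- (1 + λ log(1+t))^{x/λ} = Σ_m (x)_{m,λ} (log(1+t))^m / m!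
  -- (composition with a series of zero constant term: only m ≤ n
  --  contribute to the coefficient of t^n)
  Eλ : Carrier → Carrier → Series
  Eλ lam x n = sumTo (suc n) (λ m → fallingλ lam x m * invFact m * powS logS m n)

  -- multiplicative inverse of a series f whose constant term has inverse c0:
  -- g 0 = c0,  g (n+1) = - c0 * Σ_{k=1}^{n+1} f k * g (n+1-k).
  module _ (f : Series) (c0 : Carrier) where
    -- dot j [g_{j'}, ...] accumulates f (j+1) * g_n + f (j+2) * g_{n-1} + ...
    dot : ℕ → List Carrier → Carrier
    dot j [] = 0#
    dot j (g ∷ gs) = f (suc j) * g + dot (suc j) gs

    -- revCoeffs n = [g n, g (n-1), ..., g 0]
    revCoeffs : ℕ → List Carrier
    revCoeffs zero = c0 ∷ []
    revCoeffs (suc n) = (- (c0 * dot 0 (revCoeffs n))) ∷ revCoeffs n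

    invS : Series
    invS n with revCoeffs n
    ... | [] = 0#
    ... | g ∷ _ = g

  -- 2 / (1 + (1+λ log(1+t))^{1/λ}) * (1+λ log(1+t))^{x/λ}
  -- (constant term of 1 + E_1 is 2, whose inverse is inv 1)
  ChGen : Carrier → Carrier → Series
  ChGen lam x = scaleS (1# + 1#) (Eλ lam x) ⊛ invS (oneS ⊕ Eλ lam 1#) (inv 1)

  -- degenerate Changhee polynomial of the second kind:
  -- Ch_{n,λ}(x) = n! [t^n] ChGen
  Ch : Carrier → ℕ → Carrier → Carrier
  Ch lam n x = ι (n NB.!) * ChGen lam x n

module Submission where

-- For odd d and all n,
--   Ch_{n,λ}(d) + Ch_{n,λ} = 2 Σ_{a<d} Σ_{m≤n} (a)_{m,λ} S₁(n,m) (-1)^a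
-- in any commutative ring containing 1/1, 1/2, 1/3, ….
--
-- Write E_x = Σ_m (x)_{m,λ} log(1+t)^m / m!, so that Ch_{n,λ}(x) = n! [tⁿ] 2 E_x/(1+E_1).
--  (1) Exponential law E_{x+y} = E_x E_y: the degenerate Vandermonde
--      identity for (x)_{m,λ}/m! (proved by comparing derivatives) survives the
--      substitution t ↦ log(1+t), which is multiplicative.
--  (2) Telescoping: (1+E_1) Σ_{a<d} (-1)^a E_a = E_0 - (-1)^d E_d, so for odd d
--      E_d + E_0 = (1+E_1) Σ_{a<d} (-1)^a E_a; dividing by 1+E_1 gives the
--      generating-function identity  ChGen(d) + ChGen(0) = 2 Σ_{a<d} (-1)^a E_a.
--  (3) Stirling numbers: n!/m! [tⁿ] log(1+t)^m = S₁(n,m), from the differential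
--      equation (1+t) (log(1+t)^{m+1})' = (m+1) log(1+t)^m.
-- Taking n! [tⁿ] in (2) and expanding E_a by (3) gives the theorem.

open import Defs
open import Data.Nat as ℕ using (ℕ; suc)
open import Relation.Nullary using (¬_)
open import Algebra.Bundles using (CommutativeRing)

open import Level using (Level)
open import Data.Nat using (zero; _∸_; _≤_; _<_; z≤n; s≤s)
import Data.Nat.Base as NB
import Data.Nat.Properties as ℕP
open import Data.Integer as ℤ using (ℤ; +_; -[1+_])
import Data.Integer.Properties as ℤP
import Data.Sign as Sign
open import Data.Sum using (inj₁; inj₂)
open import Data.Maybe using (Maybe; just; nothing)
open import Relation.Nullary using (yes; no)
import Relation.Binary.PropositionalEquality as P
open import Algebra.Solver.Ring.AlmostCommutativeRing
  using (fromCommutativeRing; _-Raw-AlmostCommutative⟶_)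

module Changhee {c ℓ : Level} (R : CommutativeRing c ℓ)
                (inv : ℕ → CommutativeRing.Carrier R) where
  open CommutativeRing R
  open QAlg R inv
  open import Relation.Binary.Reasoning.Setoid setoid
  open import Algebra.Properties.Ring ring
    using (-0#≈0#; -‿involutive; -‿+-comm; -‿distribˡ-*; -‿distribʳ-*)

  ι-+ : ∀ m n → ι (m ℕ.+ n) ≈ ι m + ι n
  ι-+ zero n = sym (+-identityˡ _)
  ι-+ (suc m) n = trans (+-congˡ (ι-+ m n)) (sym (+-assoc _ _ _))

  ι-* : ∀ m n → ι (m ℕ.* n) ≈ ι m * ι n
  ι-* zero n = sym (zeroˡ _)
  ι-* (suc m) n = begin
    ι (n ℕ.+ m ℕ.* n)      ≈⟨ ι-+ n (m ℕ.* n) ⟩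
    ι n + ι (m ℕ.* n)      ≈⟨ +-cong (sym (*-identityˡ _)) (ι-* m n) ⟩
    1# * ι n + ι m * ι n   ≈⟨ sym (distribʳ _ _ _) ⟩
    (1# + ι m) * ι n       ∎

  ι-split : ∀ {k m} → k ≤ m → ι m ≈ ι k + ι (m ∸ k)
  ι-split {k} {m} k≤m = trans (reflexive (P.cong ι (P.sym (ℕP.m+[n∸m]≡n k≤m)))) (ι-+ k (m ∸ k))

  ιℤ-⊖ : ∀ m n → ιℤ (m ℤ.⊖ n) ≈ ι m - ι n
  ιℤ-⊖ zero zero = sym (trans (+-congˡ -0#≈0#) (+-identityʳ _))
  ιℤ-⊖ zero (suc n) = sym (+-identityˡ _)
  ιℤ-⊖ (suc m) zero = sym (trans (+-congˡ -0#≈0#) (+-identityʳ _))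
  ιℤ-⊖ (suc m) (suc n) = begin
    ιℤ (suc m ℤ.⊖ suc n)      ≡⟨ P.cong ιℤ (ℤP.[1+m]⊖[1+n]≡m⊖n m n) ⟩
    ιℤ (m ℤ.⊖ n)              ≈⟨ ιℤ-⊖ m n ⟩
    ι m - ι n                 ≈⟨ sym (+-identityˡ _) ⟩
    0# + (ι m - ι n)          ≈⟨ +-congʳ (sym (-‿inverseʳ 1#)) ⟩
    (1# - 1#) + (ι m - ι n)   ≈⟨ regroup ⟩
    (1# + ι m) + (- 1# - ι n) ≈⟨ +-congˡ (-‿+-comm 1# (ι n)) ⟩
    ι (suc m) - ι (suc n)     ∎
    where
    regroup : (1# - 1#) + (ι m - ι n) ≈ (1# + ι m) + (- 1# - ι n)
    regroup = begin
      (1# - 1#) + (ι m - ι n)     ≈⟨ +-assoc _ _ _ ⟩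
      1# + (- 1# + (ι m - ι n))   ≈⟨ +-congˡ (sym (+-assoc _ _ _)) ⟩
      1# + ((- 1# + ι m) - ι n)   ≈⟨ +-congˡ (+-congʳ (+-comm _ _)) ⟩
      1# + ((ι m - 1#) - ι n)     ≈⟨ +-congˡ (+-assoc _ _ _) ⟩
      1# + (ι m + (- 1# - ι n))   ≈⟨ sym (+-assoc _ _ _) ⟩
      (1# + ι m) + (- 1# - ι n)   ∎

  ιℤ-neg : ∀ i → ιℤ (ℤ.- i) ≈ - ιℤ i
  ιℤ-neg (+ zero) = sym -0#≈0#
  ιℤ-neg (+ suc n) = refl
  ιℤ-neg -[1+ n ] = sym (-‿involutive _)

  ιℤ-+ : ∀ i j → ιℤ (i ℤ.+ j) ≈ ιℤ i + ιℤ j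
  ιℤ-+ -[1+ m ] -[1+ n ] = begin
    - ι (suc (suc (m ℕ.+ n)))   ≡⟨ P.cong (λ k → - ι (suc k)) (P.sym (ℕP.+-suc m n)) ⟩
    - ι (suc m ℕ.+ suc n)       ≈⟨ -‿cong (ι-+ (suc m) (suc n)) ⟩
    - (ι (suc m) + ι (suc n))   ≈⟨ sym (-‿+-comm _ _) ⟩
    - ι (suc m) - ι (suc n)     ∎
  ιℤ-+ -[1+ m ] (+ n) = trans (ιℤ-⊖ n (suc m)) (+-comm _ _)
  ιℤ-+ (+ m) -[1+ n ] = ιℤ-⊖ m (suc n)
  ιℤ-+ (+ m) (+ n) = ι-+ m n

  -- Multiplicativity goes through the sign–magnitude decomposition of ℤ.*.
  ιSign : Sign.Sign → Carrier
  ιSign Sign.+ = 1#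
  ιSign Sign.- = - 1#

  ιSign-* : ∀ s t → ιSign (s Sign.* t) ≈ ιSign s * ιSign t
  ιSign-* Sign.+ t = sym (*-identityˡ _)
  ιSign-* Sign.- Sign.+ = sym (*-identityʳ _)
  ιSign-* Sign.- Sign.- = begin
    1#             ≈⟨ sym (-‿involutive _) ⟩
    - - 1#         ≈⟨ -‿cong (sym (*-identityʳ _)) ⟩
    - (- 1# * 1#)  ≈⟨ -‿distribʳ-* _ _ ⟩
    - 1# * - 1#    ∎

  ιℤ-◃ : ∀ s n → ιℤ (s ℤ.◃ n) ≈ ιSign s * ι n
  ιℤ-◃ s zero = sym (zeroʳ _)
  ιℤ-◃ Sign.+ (suc n) = sym (*-identityˡ _)
  ιℤ-◃ Sign.- (suc n) = trans (-‿cong (sym (*-identityˡ _))) (-‿distribˡ-* _ _)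

  ιℤ-signAbs : ∀ i → ιℤ i ≈ ιSign (ℤ.sign i) * ι ℤ.∣ i ∣
  ιℤ-signAbs i = trans (reflexive (P.cong ιℤ (P.sym (ℤP.◃-inverse i)))) (ιℤ-◃ (ℤ.sign i) ℤ.∣ i ∣)

  *-interchange : ∀ a b x y → (a * b) * (x * y) ≈ (a * x) * (b * y)
  *-interchange a b x y = begin
    (a * b) * (x * y)   ≈⟨ *-assoc _ _ _ ⟩
    a * (b * (x * y))   ≈⟨ *-congˡ (sym (*-assoc _ _ _)) ⟩
    a * ((b * x) * y)   ≈⟨ *-congˡ (*-congʳ (*-comm _ _)) ⟩
    a * ((x * b) * y)   ≈⟨ *-congˡ (*-assoc _ _ _) ⟩
    a * (x * (b * y))   ≈⟨ sym (*-assoc _ _ _) ⟩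
    (a * x) * (b * y)   ∎

  ιℤ-* : ∀ i j → ιℤ (i ℤ.* j) ≈ ιℤ i * ιℤ j
  ιℤ-* i j = begin
    ιℤ (i ℤ.* j)
      ≈⟨ ιℤ-◃ (ℤ.sign i Sign.* ℤ.sign j) (ℤ.∣ i ∣ ℕ.* ℤ.∣ j ∣) ⟩
    ιSign (ℤ.sign i Sign.* ℤ.sign j) * ι (ℤ.∣ i ∣ ℕ.* ℤ.∣ j ∣)
      ≈⟨ *-cong (ιSign-* (ℤ.sign i) (ℤ.sign j)) (ι-* ℤ.∣ i ∣ ℤ.∣ j ∣) ⟩
    (ιSign (ℤ.sign i) * ιSign (ℤ.sign j)) * (ι ℤ.∣ i ∣ * ι ℤ.∣ j ∣)
      ≈⟨ *-interchange _ _ _ _ ⟩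
    (ιSign (ℤ.sign i) * ι ℤ.∣ i ∣) * (ιSign (ℤ.sign j) * ι ℤ.∣ j ∣)
      ≈⟨ sym (*-cong (ιℤ-signAbs i) (ιℤ-signAbs j)) ⟩
    ιℤ i * ιℤ j ∎

  -- ιℤ is a ring homomorphism; this instantiates the ring solver for R with
  -- integer coefficients (equality of coefficients decided in ℤ).
  ιℤ-homomorphism : ℤ.+-*-rawRing -Raw-AlmostCommutative⟶ fromCommutativeRing R
  ιℤ-homomorphism = record
    { ⟦_⟧ = ιℤ ; +-homo = ιℤ-+ ; *-homo = ιℤ-* ; -‿homo = ιℤ-neg
    ; 0-homo = refl ; 1-homo = +-identityʳ _ }

  ιℤ-equal? : ∀ i j → Maybe (ιℤ i ≈ ιℤ j)
  ιℤ-equal? i j with i ℤ.≟ j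
  ... | yes P.refl = just refl
  ... | no _ = nothing

  open import Algebra.Solver.Ring ℤ.+-*-rawRing (fromCommutativeRing R) ιℤ-homomorphism ιℤ-equal?
    using (solve; _:+_; _:*_; _:-_; :-_; _:=_)

  sgn-odd : ∀ k → sgn (suc (2 ℕ.* k)) ≈ - 1#
  sgn-odd zero = refl
  sgn-odd (suc k) = begin
    sgn (suc (2 ℕ.* suc k))       ≡⟨ P.cong (λ j → sgn (suc j)) (P.cong suc (ℕP.+-suc k (k ℕ.+ 0))) ⟩
    - - sgn (suc (2 ℕ.* k))       ≈⟨ -‿involutive _ ⟩
    sgn (suc (2 ℕ.* k))           ≈⟨ sgn-odd k ⟩
    - 1#                          ∎

  sum-cong : ∀ n {f g} → (∀ i → f i ≈ g i) → sumTo n f ≈ sumTo n g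
  sum-cong zero eq = refl
  sum-cong (suc n) eq = +-cong (sum-cong n eq) (eq n)

  sum-cong< : ∀ n {f g} → (∀ i → i < n → f i ≈ g i) → sumTo n f ≈ sumTo n g
  sum-cong< zero eq = refl
  sum-cong< (suc n) eq = +-cong (sum-cong< n (λ i i<n → eq i (ℕP.m<n⇒m<1+n i<n))) (eq n ℕP.≤-refl)

  sum-zero : ∀ n {f} → (∀ i → i < n → f i ≈ 0#) → sumTo n f ≈ 0#
  sum-zero n vanish = trans (sum-cong< n vanish) (sumOfZeros n)
    where
    sumOfZeros : ∀ n → sumTo n (λ _ → 0#) ≈ 0#
    sumOfZeros zero = refl
    sumOfZeros (suc n) = trans (+-identityʳ _) (sumOfZeros n)

  sum-+ : ∀ n f g → sumTo n (λ i → f i + g i) ≈ sumTo n f + sumTo n g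
  sum-+ zero f g = sym (+-identityˡ _)
  sum-+ (suc n) f g = trans (+-congʳ (sum-+ n f g))
    (solve 4 (λ a b x y → (a :+ b) :+ (x :+ y) := (a :+ x) :+ (b :+ y)) refl _ _ _ _)

  sum-*ˡ : ∀ n a f → a * sumTo n f ≈ sumTo n (λ i → a * f i)
  sum-*ˡ zero a f = zeroʳ _
  sum-*ˡ (suc n) a f = trans (distribˡ _ _ _) (+-congʳ (sum-*ˡ n a f))

  sum-*ʳ : ∀ n a f → sumTo n f * a ≈ sumTo n (λ i → f i * a)
  sum-*ʳ n a f = trans (*-comm _ _) (trans (sum-*ˡ n a f) (sum-cong n (λ i → *-comm _ _)))

  sum-unconsˡ : ∀ n f → sumTo (suc n) f ≈ f 0 + sumTo n (λ i → f (suc i))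
  sum-unconsˡ zero f = trans (+-identityˡ _) (sym (+-identityʳ _))
  sum-unconsˡ (suc n) f = trans (+-congʳ (sum-unconsˡ n f)) (+-assoc _ _ _)

  sum-swap : ∀ n m (A : ℕ → ℕ → Carrier) →
             sumTo n (λ i → sumTo m (A i)) ≈ sumTo m (λ j → sumTo n (λ i → A i j))
  sum-swap zero m A = sym (sum-zero m (λ _ _ → refl))
  sum-swap (suc n) m A = trans (+-congʳ (sum-swap n m A)) (sym (sum-+ m _ _))

  sum-pad : ∀ {m} n {f} → m ≤ n → (∀ i → m ≤ i → i < n → f i ≈ 0#) → sumTo n f ≈ sumTo m f
  sum-pad zero z≤n vanish = refl
  sum-pad (suc n) m≤1+n vanish with ℕP.m≤n⇒m<n∨m≡n m≤1+n
  ... | inj₂ P.refl = refl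
  ... | inj₁ (s≤s m≤n) = trans
    (+-cong (sum-pad n m≤n (λ i m≤i i<n → vanish i m≤i (ℕP.m<n⇒m<1+n i<n))) (vanish n m≤n ℕP.≤-refl))
    (+-identityʳ _)

  sum-reverse : ∀ n (h : ℕ → Carrier) → sumTo (suc n) h ≈ sumTo (suc n) (λ k → h (n ∸ k))
  sum-reverse zero h = refl
  sum-reverse (suc n) h = begin
    sumTo (suc n) h + h (suc n)                      ≈⟨ +-congʳ (sum-reverse n h) ⟩
    sumTo (suc n) (λ k → h (n ∸ k)) + h (suc n)      ≈⟨ +-comm _ _ ⟩
    h (suc n) + sumTo (suc n) (λ k → h (n ∸ k))      ≈⟨ sym (sum-unconsˡ (suc n) (λ k → h (suc n ∸ k))) ⟩
    sumTo (suc (suc n)) (λ k → h (suc n ∸ k))        ∎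

  -- Σ_{k≤n} Σ_{i≤k} A i (k-i) = Σ_{i≤n} Σ_{j≤n-i} A i j : both run over i + j ≤ n.
  sum-triangle : ∀ n (A : ℕ → ℕ → Carrier) →
                 sumTo (suc n) (λ k → sumTo (suc k) (λ i → A i (k ∸ i)))
                   ≈ sumTo (suc n) (λ i → sumTo (suc (n ∸ i)) (A i))
  sum-triangle zero A = refl
  sum-triangle (suc n) A = begin
    sumTo (suc n) (λ k → sumTo (suc k) (λ i → A i (k ∸ i))) + sumTo (suc (suc n)) (λ i → A i (suc n ∸ i))
      ≈⟨ +-congʳ (sum-triangle n A) ⟩
    sumTo (suc n) (λ i → sumTo (suc (n ∸ i)) (A i)) + (sumTo (suc n) (λ i → A i (suc n ∸ i)) + A (suc n) (n ∸ n))
      ≈⟨ sym (+-assoc _ _ _) ⟩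
    (sumTo (suc n) (λ i → sumTo (suc (n ∸ i)) (A i)) + sumTo (suc n) (λ i → A i (suc n ∸ i))) + A (suc n) (n ∸ n)
      ≈⟨ +-cong (sym (sum-+ (suc n) _ _)) (sym (trans (+-congʳ (sum-zero (n ∸ n) emptyRange)) (+-identityˡ _))) ⟩
    sumTo (suc n) (λ i → sumTo (suc (n ∸ i)) (A i) + A i (suc n ∸ i)) + sumTo (suc (n ∸ n)) (A (suc n))
      ≈⟨ +-congʳ (sum-cong< (suc n) extendRow) ⟩
    sumTo (suc (suc n)) (λ i → sumTo (suc (suc n ∸ i)) (A i)) ∎
    where
    extendRow : ∀ i → i < suc n →
                sumTo (suc (n ∸ i)) (A i) + A i (suc n ∸ i) ≈ sumTo (suc (suc n ∸ i)) (A i)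
    extendRow i (s≤s i≤n) rewrite ℕP.+-∸-assoc 1 i≤n = refl
    emptyRange : ∀ j → j < n ∸ n → A (suc n) j ≈ 0#
    emptyRange j j<0 rewrite ℕP.n∸n≡0 n with j<0
    ... | ()

  -- Formal power series, given by their coefficient functions, form a
  -- commutative ring under  ⊕, ⊛  up to coefficientwise equality  ≋.

  infix 4 _≋_
  _≋_ : Series → Series → Set ℓ
  f ≋ g = ∀ n → f n ≈ g n

  ≋-refl : ∀ {f} → f ≋ f
  ≋-refl n = refl

  ≋-trans : ∀ {f g h} → f ≋ g → g ≋ h → f ≋ h
  ≋-trans p q n = trans (p n) (q n)

  ⊛-cong : ∀ {f f' g g'} → f ≋ f' → g ≋ g' → (f ⊛ g) ≋ (f' ⊛ g')
  ⊛-cong p q n = sum-cong (suc n) (λ k → *-cong (p k) (q (n ∸ k)))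

  ⊛-comm : ∀ f g → (f ⊛ g) ≋ (g ⊛ f)
  ⊛-comm f g n = trans (sum-reverse n _) (sum-cong< (suc n) swapFactors)
    where
    swapFactors : ∀ k → k < suc n → f (n ∸ k) * g (n ∸ (n ∸ k)) ≈ g k * f (n ∸ k)
    swapFactors k (s≤s k≤n) rewrite ℕP.m∸[m∸n]≡n k≤n = *-comm _ _

  ⊛-distribʳ : ∀ f g h → ((f ⊕ g) ⊛ h) ≋ ((f ⊛ h) ⊕ (g ⊛ h))
  ⊛-distribʳ f g h n = trans (sum-cong (suc n) (λ k → distribʳ _ _ _)) (sum-+ (suc n) _ _)

  ⊛-distribˡ : ∀ f g h → (h ⊛ (f ⊕ g)) ≋ ((h ⊛ f) ⊕ (h ⊛ g))
  ⊛-distribˡ f g h n = trans (sum-cong (suc n) (λ k → distribˡ _ _ _)) (sum-+ (suc n) _ _)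

  ⊛-scaleˡ : ∀ a f g → (scaleS a f ⊛ g) ≋ scaleS a (f ⊛ g)
  ⊛-scaleˡ a f g n = trans (sum-cong (suc n) (λ k → *-assoc _ _ _)) (sym (sum-*ˡ (suc n) a _))

  ⊛-scaleʳ : ∀ a f g → (f ⊛ scaleS a g) ≋ scaleS a (f ⊛ g)
  ⊛-scaleʳ a f g n = trans (sum-cong (suc n) (λ k →
       solve 3 (λ x y z → x :* (y :* z) := y :* (x :* z)) refl _ _ _)) (sym (sum-*ˡ (suc n) a _))

  ⊛-identityˡ : ∀ f → (oneS ⊛ f) ≋ f
  ⊛-identityˡ f n = begin
    sumTo (suc n) (λ k → oneS k * f (n ∸ k))           ≈⟨ sum-unconsˡ n _ ⟩
    1# * f n + sumTo n (λ k → 0# * f (n ∸ suc k))      ≈⟨ +-cong (*-identityˡ _) (sum-zero n (λ i _ → zeroˡ _)) ⟩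
    f n + 0#                                          ≈⟨ +-identityʳ _ ⟩
    f n                                               ∎

  ⊛-identityʳ : ∀ f → (f ⊛ oneS) ≋ f
  ⊛-identityʳ f = ≋-trans (⊛-comm f oneS) (⊛-identityˡ f)

  ⊛-assoc : ∀ f g h → ((f ⊛ g) ⊛ h) ≋ (f ⊛ (g ⊛ h))
  ⊛-assoc f g h n = begin
    sumTo (suc n) (λ k → sumTo (suc k) (λ i → f i * g (k ∸ i)) * h (n ∸ k))
      ≈⟨ sum-cong (suc n) (λ k → trans (sum-*ʳ (suc k) _ _) (sum-cong< (suc k) (left k))) ⟩
    sumTo (suc n) (λ k → sumTo (suc k) (λ i → A i (k ∸ i)))
      ≈⟨ sum-triangle n A ⟩
    sumTo (suc n) (λ i → sumTo (suc (n ∸ i)) (A i))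
      ≈⟨ sum-cong (suc n) (λ i → sym (trans (sum-*ˡ (suc (n ∸ i)) _ _) (sum-cong (suc (n ∸ i)) (right i)))) ⟩
    sumTo (suc n) (λ i → f i * sumTo (suc (n ∸ i)) (λ j → g j * h (n ∸ i ∸ j))) ∎
    where
    -- the common form  f_i g_j h_{n-i-j}  of both sides
    A : ℕ → ℕ → Carrier
    A i j = f i * g j * h (n ∸ (i ℕ.+ j))
    left : ∀ k i → i < suc k → f i * g (k ∸ i) * h (n ∸ k) ≈ A i (k ∸ i)
    left k i (s≤s i≤k) rewrite ℕP.m+[n∸m]≡n i≤k = refl
    right : ∀ i j → f i * (g j * h (n ∸ i ∸ j)) ≈ A i j
    right i j rewrite ℕP.∸-+-assoc n i j = sym (*-assoc _ _ _)

  module _ (f : Series) (c₀ : Carrier) (c₀-inverts : c₀ * f 0 ≈ 1#) where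

    dot-as-sum : ∀ n j → dot f c₀ j (revCoeffs f c₀ n)
                         ≈ sumTo (suc n) (λ i → f (suc (j ℕ.+ i)) * invS f c₀ (n ∸ i))
    dot-as-sum zero j rewrite ℕP.+-identityʳ j = trans (+-identityʳ _) (sym (+-identityˡ _))
    dot-as-sum (suc n) j = begin
      f (suc j) * g (suc n) + dot f c₀ (suc j) (revCoeffs f c₀ n)
        ≈⟨ +-congˡ (dot-as-sum n (suc j)) ⟩
      f (suc j) * g (suc n) + sumTo (suc n) (λ i → f (suc (suc j ℕ.+ i)) * g (n ∸ i))
        ≈⟨ +-cong (reflexive (P.cong (λ z → f (suc z) * g (suc n)) (P.sym (ℕP.+-identityʳ j))))
                  (sum-cong (suc n) (λ i → reflexive (P.cong (λ z → f (suc z) * g (n ∸ i)) (P.sym (ℕP.+-suc j i))))) ⟩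
      f (suc (j ℕ.+ 0)) * g (suc n) + sumTo (suc n) (λ i → f (suc (j ℕ.+ suc i)) * g (n ∸ i))
        ≈⟨ sym (sum-unconsˡ (suc n) _) ⟩
      sumTo (suc (suc n)) (λ i → f (suc (j ℕ.+ i)) * g (suc n ∸ i)) ∎
      where
      g : Series
      g = invS f c₀

    ⊛-inverse : (f ⊛ invS f c₀) ≋ oneS
    ⊛-inverse zero = trans (+-identityˡ _) (trans (*-comm _ _) c₀-inverts)
    ⊛-inverse (suc n) = begin
      sumTo (suc (suc n)) (λ k → f k * invS f c₀ (suc n ∸ k))
        ≈⟨ sum-unconsˡ (suc n) _ ⟩
      f 0 * - (c₀ * tail) + sumTo (suc n) (λ i → f (suc i) * invS f c₀ (n ∸ i))
        ≈⟨ +-cong (solve 3 (λ a b d → a :* (:- (b :* d)) := :- ((b :* a) :* d)) refl _ _ _) (sym (dot-as-sum n 0)) ⟩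
      - ((c₀ * f 0) * tail) + tail
        ≈⟨ +-congʳ (-‿cong (trans (*-congʳ c₀-inverts) (*-identityˡ _))) ⟩
      - tail + tail ≈⟨ -‿inverseˡ _ ⟩
      0# ∎
      where
      tail : Carrier
      tail = dot f c₀ 0 (revCoeffs f c₀ n)

  -- From here on inv k is the inverse of k+1, so derivatives and log(1+t)
  -- make sense.

  module WithInverses (inv-spec : ∀ k → ι (suc k) * inv k ≈ 1#) where

    inv-specʳ : ∀ k → inv k * ι (suc k) ≈ 1#
    inv-specʳ k = trans (*-comm _ _) (inv-spec k)

    deriv : Series → Series
    deriv f n = ι (suc n) * f (suc n)

    timesT : Series → Series
    timesT f zero = 0#
    timesT f (suc n) = f n

    onePlusT : Series → Series
    onePlusT f = f ⊕ timesT f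

    -- Leibniz rule: (fg)' = f'g + fg'.  The factor n+1 of the (n+1)-st
    -- coefficient splits as k + (n+1-k) in each product term f_k g_{n+1-k}.
    deriv-⊛ : ∀ f g → deriv (f ⊛ g) ≋ ((deriv f ⊛ g) ⊕ (f ⊛ deriv g))
    deriv-⊛ f g n = begin
      ι (suc n) * sumTo (suc (suc n)) (λ k → f k * g (suc n ∸ k))
        ≈⟨ sum-*ˡ (suc (suc n)) _ _ ⟩
      sumTo (suc (suc n)) (λ k → ι (suc n) * (f k * g (suc n ∸ k)))
        ≈⟨ sum-cong< (suc (suc n)) splitFactor ⟩
      sumTo (suc (suc n)) (λ k → ι k * f k * g (suc n ∸ k) + f k * (ι (suc n ∸ k) * g (suc n ∸ k)))
        ≈⟨ sum-+ (suc (suc n)) _ _ ⟩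
      sumTo (suc (suc n)) (λ k → ι k * f k * g (suc n ∸ k))
        + sumTo (suc (suc n)) (λ k → f k * (ι (suc n ∸ k) * g (suc n ∸ k)))
        ≈⟨ +-cong derivLeft derivRight ⟩
      (deriv f ⊛ g) n + (f ⊛ deriv g) n ∎
      where
      splitFactor : ∀ k → k < suc (suc n) →
        ι (suc n) * (f k * g (suc n ∸ k)) ≈ ι k * f k * g (suc n ∸ k) + f k * (ι (suc n ∸ k) * g (suc n ∸ k))
      splitFactor k (s≤s k≤1+n) = trans (*-congʳ (ι-split k≤1+n))
         (solve 4 (λ a b x y → (a :+ b) :* (x :* y) := a :* x :* y :+ x :* (b :* y)) refl _ _ _ _)
      -- the k = 0 term vanishes
      derivLeft : sumTo (suc (suc n)) (λ k → ι k * f k * g (suc n ∸ k)) ≈ (deriv f ⊛ g) n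
      derivLeft = trans (sum-unconsˡ (suc n) _)
        (trans (+-congʳ (trans (*-congʳ (zeroˡ _)) (zeroˡ _))) (+-identityˡ _))
      -- the k = n+1 term vanishes
      derivRight : sumTo (suc (suc n)) (λ k → f k * (ι (suc n ∸ k) * g (suc n ∸ k))) ≈ (f ⊛ deriv g) n
      derivRight = trans (+-cong (sum-cong< (suc n) shiftIndex) lastTerm) (+-identityʳ _)
        where
        shiftIndex : ∀ k → k < suc n → f k * (ι (suc n ∸ k) * g (suc n ∸ k)) ≈ f k * deriv g (n ∸ k)
        shiftIndex k (s≤s k≤n) rewrite ℕP.+-∸-assoc 1 k≤n = refl
        lastTerm : f (suc n) * (ι (n ∸ n) * g (n ∸ n)) ≈ 0#
        lastTerm rewrite ℕP.n∸n≡0 n = trans (*-congˡ (zeroˡ _)) (zeroʳ _)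

    timesT-⊛ : ∀ f g → timesT (f ⊛ g) ≋ (timesT f ⊛ g)
    timesT-⊛ f g zero = sym (trans (+-identityˡ _) (zeroˡ _))
    timesT-⊛ f g (suc n) = sym (trans (sum-unconsˡ (suc n) _) (trans (+-congʳ (zeroˡ _)) (+-identityˡ _)))

    onePlusT-⊛ : ∀ f g → onePlusT (f ⊛ g) ≋ (onePlusT f ⊛ g)
    onePlusT-⊛ f g n = trans (+-congˡ (timesT-⊛ f g n)) (sym (⊛-distribʳ f (timesT f) g n))

    onePlusT-cong : ∀ {f g} → f ≋ g → onePlusT f ≋ onePlusT g
    onePlusT-cong p zero = +-cong (p 0) refl
    onePlusT-cong p (suc n) = +-cong (p (suc n)) (p n)

    onePlusT-⊕ : ∀ f g → onePlusT (f ⊕ g) ≋ (onePlusT f ⊕ onePlusT g)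
    onePlusT-⊕ f g zero = sym (trans (+-cong (+-identityʳ _) (+-identityʳ _)) (sym (+-identityʳ _)))
    onePlusT-⊕ f g (suc n) = solve 4 (λ a b x y → (a :+ b) :+ (x :+ y) := (a :+ x) :+ (b :+ y)) refl _ _ _ _

    onePlusT-deriv : ∀ f n → onePlusT (deriv f) n ≈ ι (suc n) * f (suc n) + ι n * f n
    onePlusT-deriv f zero = +-congˡ (sym (zeroˡ _))
    onePlusT-deriv f (suc n) = refl

    deriv-log : ∀ n → deriv logS n ≈ sgn n
    deriv-log n = trans (solve 3 (λ a s b → a :* (s :* b) := s :* (a :* b)) refl _ _ _)
                        (trans (*-congˡ (inv-spec n)) (*-identityʳ _))

    onePlusT-deriv-log : onePlusT (deriv logS) ≋ oneS
    onePlusT-deriv-log zero = trans (+-identityʳ _) (deriv-log 0)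
    onePlusT-deriv-log (suc n) = trans (+-cong (deriv-log (suc n)) (deriv-log n)) (-‿inverseˡ _)

    logPow : ℕ → Series
    logPow = powS logS

    logPow-vanish : ∀ m n → n < m → logPow m n ≈ 0#
    logPow-vanish (suc m) n (s≤s n≤m) = begin
      sumTo (suc n) (λ k → logS k * logPow m (n ∸ k))          ≈⟨ sum-unconsˡ n _ ⟩
      0# * logPow m n + sumTo n (λ k → logS (suc k) * logPow m (n ∸ suc k))
        ≈⟨ +-cong (zeroˡ _) (sum-zero n (λ k k<n → trans (*-congˡ (logPow-vanish m _ (below k<n))) (zeroʳ _))) ⟩
      0# + 0#                                                  ≈⟨ +-identityˡ _ ⟩
      0#                                                       ∎
      where
      below : ∀ {k} → k < n → n ∸ suc k < m
      below {k} (s≤s k<n) = ℕP.<-≤-trans (s≤s (ℕP.m∸n≤m _ k)) n≤m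

    logPow-+ : ∀ i j → (logPow i ⊛ logPow j) ≋ logPow (i ℕ.+ j)
    logPow-+ zero j = ⊛-identityˡ (logPow j)
    logPow-+ (suc i) j = ≋-trans (⊛-assoc logS (logPow i) (logPow j)) (⊛-cong ≋-refl (logPow-+ i j))

    -- Leibniz on log · log^m, using (1+t) log' = 1.
    onePlusT-deriv-logPow : ∀ m →
      onePlusT (deriv (logPow (suc m))) ≋ (logPow m ⊕ (onePlusT (deriv (logPow m)) ⊛ logS))
    onePlusT-deriv-logPow m n = begin
      onePlusT (deriv (logS ⊛ logPow m)) n
        ≈⟨ onePlusT-cong (deriv-⊛ logS (logPow m)) n ⟩
      onePlusT ((deriv logS ⊛ logPow m) ⊕ (logS ⊛ deriv (logPow m))) n
        ≈⟨ onePlusT-⊕ _ _ n ⟩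
      onePlusT (deriv logS ⊛ logPow m) n + onePlusT (logS ⊛ deriv (logPow m)) n
        ≈⟨ +-cong (onePlusT-⊛ (deriv logS) (logPow m) n) (onePlusT-cong (⊛-comm logS (deriv (logPow m))) n) ⟩
      (onePlusT (deriv logS) ⊛ logPow m) n + onePlusT (deriv (logPow m) ⊛ logS) n
        ≈⟨ +-cong (⊛-cong {g = logPow m} onePlusT-deriv-log ≋-refl n) (onePlusT-⊛ (deriv (logPow m)) logS n) ⟩
      (oneS ⊛ logPow m) n + (onePlusT (deriv (logPow m)) ⊛ logS) n
        ≈⟨ +-congʳ (⊛-identityˡ (logPow m) n) ⟩
      logPow m n + (onePlusT (deriv (logPow m)) ⊛ logS) n ∎

    logPow-ode : ∀ m → (onePlusT (deriv (logPow m)) ⊛ logS) ≋ scaleS (ι m) (logPow m)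
    logPow-ode zero n = trans (sum-zero (suc n) (λ k _ → trans (*-congʳ (constantDeriv k)) (zeroˡ _)))
                              (sym (zeroˡ _))
      where
      constantDeriv : ∀ k → onePlusT (deriv (logPow 0)) k ≈ 0#
      constantDeriv zero = trans (+-identityʳ _) (zeroʳ _)
      constantDeriv (suc k) = trans (+-cong (zeroʳ _) (zeroʳ _)) (+-identityʳ _)
    logPow-ode (suc m) n = begin
      (onePlusT (deriv (logPow (suc m))) ⊛ logS) n
        ≈⟨ ⊛-cong {g = logS} (≋-trans (onePlusT-deriv-logPow m) (λ k → +-congˡ (logPow-ode m k))) ≋-refl n ⟩
      ((logPow m ⊕ scaleS (ι m) (logPow m)) ⊛ logS) n
        ≈⟨ ⊛-cong {g = logS} (λ k → trans (+-congʳ (sym (*-identityˡ _))) (sym (distribʳ _ _ _))) ≋-refl n ⟩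
      (scaleS (ι (suc m)) (logPow m) ⊛ logS) n
        ≈⟨ ⊛-scaleˡ (ι (suc m)) (logPow m) logS n ⟩
      ι (suc m) * (logPow m ⊛ logS) n
        ≈⟨ *-congˡ (⊛-comm (logPow m) logS n) ⟩
      ι (suc m) * logPow (suc m) n ∎

    -- Coefficient form of (1+t) (log^{m+1})' = (m+1) log^m.
    logPow-recurrence : ∀ m n →
      ι (suc n) * logPow (suc m) (suc n) ≈ ι (suc m) * logPow m n - ι n * logPow (suc m) n
    logPow-recurrence m n = begin
      ι (suc n) * logPow (suc m) (suc n)
        ≈⟨ solve 2 (λ a b → a := (a :+ b) :- b) refl _ _ ⟩
      (ι (suc n) * logPow (suc m) (suc n) + ι n * logPow (suc m) n) - ι n * logPow (suc m) n
        ≈⟨ +-congʳ (sym (onePlusT-deriv (logPow (suc m)) n)) ⟩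
      onePlusT (deriv (logPow (suc m))) n - ι n * logPow (suc m) n
        ≈⟨ +-congʳ (trans (onePlusT-deriv-logPow m n) (+-congˡ (logPow-ode m n))) ⟩
      (logPow m n + ι m * logPow m n) - ι n * logPow (suc m) n
        ≈⟨ +-congʳ (trans (+-congʳ (sym (*-identityˡ _))) (sym (distribʳ _ _ _))) ⟩
      ι (suc m) * logPow m n - ι n * logPow (suc m) n ∎

    -- n!/m! [tⁿ] log(1+t)^m = S₁(n,m): both sides satisfy the Stirling recurrence.
    stirling-coefficient : ∀ n m → ι (n NB.!) * (invFact m * logPow m n) ≈ ιℤ (S1 n m)
    stirling-coefficient zero zero = trans (*-congˡ (*-identityˡ _)) (*-identityʳ _)
    stirling-coefficient zero (suc m) =
      trans (*-congˡ (trans (*-congˡ (logPow-vanish (suc m) 0 (s≤s z≤n))) (zeroʳ _))) (zeroʳ _)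
    stirling-coefficient (suc n) zero = trans (*-congˡ (zeroʳ _)) (zeroʳ _)
    stirling-coefficient (suc n) (suc m) = begin
      ι (suc n NB.!) * (I * v * p₁)
        ≈⟨ *-congʳ (ι-* (suc n) (n NB.!)) ⟩
      (ι (suc n) * a) * (I * v * p₁)
        ≈⟨ solve 5 (λ s a I v p → (s :* a) :* (I :* v :* p) := (a :* I :* v) :* (s :* p)) refl _ _ _ _ _ ⟩
      (a * I * v) * (ι (suc n) * p₁)
        ≈⟨ *-congˡ (logPow-recurrence m n) ⟩
      (a * I * v) * (ι (suc m) * q - ι n * p₀)
        ≈⟨ solve 7 (λ a I v u q t p₀ → (a :* I :* v) :* (u :* q :- t :* p₀)
                                      := (a :* (I :* q)) :* (u :* v) :- t :* (a :* (I :* v :* p₀)))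
                 refl a I v (ι (suc m)) q (ι n) p₀ ⟩
      (a * (I * q)) * (ι (suc m) * v) - ι n * (a * (I * v * p₀))
        ≈⟨ +-cong (trans (*-congˡ (inv-spec m)) (*-identityʳ _)) (-‿cong (*-congˡ (stirling-coefficient n (suc m)))) ⟩
      a * (I * q) - ι n * ιℤ (S1 n (suc m))
        ≈⟨ +-congʳ (stirling-coefficient n m) ⟩
      ιℤ (S1 n m) - ι n * ιℤ (S1 n (suc m))
        ≈⟨ +-congˡ (-‿cong (sym (ιℤ-* (+ n) (S1 n (suc m))))) ⟩
      ιℤ (S1 n m) - ιℤ (+ n ℤ.* S1 n (suc m))
        ≈⟨ +-congˡ (sym (ιℤ-neg (+ n ℤ.* S1 n (suc m)))) ⟩
      ιℤ (S1 n m) + ιℤ (ℤ.- (+ n ℤ.* S1 n (suc m)))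
        ≈⟨ sym (ιℤ-+ (S1 n m) (ℤ.- (+ n ℤ.* S1 n (suc m)))) ⟩
      ιℤ (S1 n m ℤ.- + n ℤ.* S1 n (suc m)) ∎
      where
      a : Carrier
      a = ι (n NB.!)
      I : Carrier
      I = invFact m
      v : Carrier
      v = inv m
      p₁ : Carrier
      p₁ = logPow (suc m) (suc n)
      p₀ : Carrier
      p₀ = logPow (suc m) n
      q : Carrier
      q = logPow m n

    -- Substitution  c(t) ↦ c(log(1+t)) = Σ_m c_m log(1+t)^m  is multiplicative.

    substLog : Series → Series
    substLog c n = sumTo (suc n) (λ m → c m * logPow m n)

    substLog-cong : ∀ {c c'} → c ≋ c' → substLog c ≋ substLog c'
    substLog-cong p n = sum-cong (suc n) (λ m → *-congʳ (p m))

    -- terms with m > n vanish, so the range may be enlarged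
    substLog-pad : ∀ c {k} n → k ≤ n → substLog c k ≈ sumTo (suc n) (λ m → c m * logPow m k)
    substLog-pad c n k≤n = sym (sum-pad (suc n) (s≤s k≤n)
       (λ i k<i _ → trans (*-congˡ (logPow-vanish i _ k<i)) (zeroʳ _)))

    substLog-⊛-expand : ∀ c d n →
      substLog (c ⊛ d) n ≈ sumTo (suc n) (λ i → sumTo (suc n) (λ j → (c i * d j) * logPow (i ℕ.+ j) n))
    substLog-⊛-expand c d n = begin
      sumTo (suc n) (λ m → sumTo (suc m) (λ i → c i * d (m ∸ i)) * logPow m n)
        ≈⟨ sum-cong (suc n) (λ m → trans (sum-*ʳ (suc m) _ _) (sum-cong< (suc m) (reindex m))) ⟩
      sumTo (suc n) (λ m → sumTo (suc m) (λ i → A i (m ∸ i)))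
        ≈⟨ sum-triangle n A ⟩
      sumTo (suc n) (λ i → sumTo (suc (n ∸ i)) (A i))
        ≈⟨ sum-cong< (suc n) (λ i i≤n → sym (sum-pad (suc n) (s≤s (ℕP.m∸n≤m n i)) (beyond i≤n))) ⟩
      sumTo (suc n) (λ i → sumTo (suc n) (A i)) ∎
      where
      A : ℕ → ℕ → Carrier
      A i j = (c i * d j) * logPow (i ℕ.+ j) n
      reindex : ∀ m i → i < suc m → c i * d (m ∸ i) * logPow m n ≈ A i (m ∸ i)
      reindex m i (s≤s i≤m) rewrite ℕP.m+[n∸m]≡n i≤m = refl
      beyond : ∀ {i} → i < suc n → ∀ j → suc (n ∸ i) ≤ j → j < suc n → A i j ≈ 0#
      beyond {i} (s≤s i≤n) j n-i<j _ = trans (*-congˡ (logPow-vanish (i ℕ.+ j) n n<i+j)) (zeroʳ _)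
        where
        n<i+j : n < i ℕ.+ j
        n<i+j = P.subst (_< i ℕ.+ j) (ℕP.m+[n∸m]≡n i≤n) (ℕP.+-monoʳ-< i n-i<j)

    ⊛-substLog-expand : ∀ c d n →
      (substLog c ⊛ substLog d) n
        ≈ sumTo (suc n) (λ i → sumTo (suc n) (λ j → (c i * d j) * (logPow i ⊛ logPow j) n))
    ⊛-substLog-expand c d n = begin
      sumTo (suc n) (λ k → substLog c k * substLog d (n ∸ k))
        ≈⟨ sum-cong< (suc n) (λ k k≤n → productTerm k k≤n) ⟩
      sumTo (suc n) (λ k → sumTo (suc n) (λ i → sumTo (suc n) (λ j → B k i j)))
        ≈⟨ sum-swap (suc n) (suc n) _ ⟩
      sumTo (suc n) (λ i → sumTo (suc n) (λ k → sumTo (suc n) (λ j → B k i j)))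
        ≈⟨ sum-cong (suc n) (λ i → sum-swap (suc n) (suc n) (λ k j → B k i j)) ⟩
      sumTo (suc n) (λ i → sumTo (suc n) (λ j → sumTo (suc n) (λ k → B k i j)))
        ≈⟨ sum-cong (suc n) (λ i → sum-cong (suc n) (λ j → sym (sum-*ˡ (suc n) _ _))) ⟩
      sumTo (suc n) (λ i → sumTo (suc n) (λ j → (c i * d j) * (logPow i ⊛ logPow j) n)) ∎
      where
      B : ℕ → ℕ → ℕ → Carrier
      B k i j = (c i * d j) * (logPow i k * logPow j (n ∸ k))
      productTerm : ∀ k → k < suc n →
        substLog c k * substLog d (n ∸ k) ≈ sumTo (suc n) (λ i → sumTo (suc n) (λ j → B k i j))
      productTerm k (s≤s k≤n) = begin
        substLog c k * substLog d (n ∸ k)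
          ≈⟨ *-cong (substLog-pad c n k≤n) (substLog-pad d n (ℕP.m∸n≤m n k)) ⟩
        sumTo (suc n) (λ i → c i * logPow i k) * sumTo (suc n) (λ j → d j * logPow j (n ∸ k))
          ≈⟨ sum-*ʳ (suc n) _ _ ⟩
        sumTo (suc n) (λ i → c i * logPow i k * sumTo (suc n) (λ j → d j * logPow j (n ∸ k)))
          ≈⟨ sum-cong (suc n) (λ i → trans (sum-*ˡ (suc n) _ _) (sum-cong (suc n) (λ j → *-interchange _ _ _ _))) ⟩
        sumTo (suc n) (λ i → sumTo (suc n) (λ j → B k i j)) ∎

    substLog-⊛ : ∀ c d → substLog (c ⊛ d) ≋ (substLog c ⊛ substLog d)
    substLog-⊛ c d n = begin
      substLog (c ⊛ d) n
        ≈⟨ substLog-⊛-expand c d n ⟩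
      sumTo (suc n) (λ i → sumTo (suc n) (λ j → (c i * d j) * logPow (i ℕ.+ j) n))
        ≈⟨ sum-cong (suc n) (λ i → sum-cong (suc n) (λ j → *-congˡ (sym (logPow-+ i j n)))) ⟩
      sumTo (suc n) (λ i → sumTo (suc n) (λ j → (c i * d j) * (logPow i ⊛ logPow j) n))
        ≈⟨ sym (⊛-substLog-expand c d n) ⟩
      (substLog c ⊛ substLog d) n ∎

    module WithParameter (lam : Carrier) where

      -- coefficients (x)_{m,λ}/m! of (1+λu)^{x/λ}; E_x is their substitution
      -- at u = log(1+t)
      fallingSeries : Carrier → Series
      fallingSeries x m = fallingλ lam x m * invFact m

      -- (m+1) · (x)_{m+1,λ}/(m+1)! = (x)_{m,λ}/m! · (x - mλ), the coefficient form of
      -- (1+λu) d/du (1+λu)^{x/λ} = x (1+λu)^{x/λ}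
      deriv-fallingSeries : ∀ x m → deriv (fallingSeries x) m ≈ fallingSeries x m * (x - ι m * lam)
      deriv-fallingSeries x m =
        trans (solve 5 (λ a f y i v → a :* (f :* y :* (i :* v)) := (f :* i :* y) :* (a :* v)) refl _ _ _ _ _)
              (trans (*-congˡ (inv-spec m)) (*-identityʳ _))

      -- the convolution of the coefficient sequences for x and y satisfies the
      -- same recurrence with x + y in place of x
      deriv-fallingProduct : ∀ x y m →
        deriv (fallingSeries x ⊛ fallingSeries y) m ≈ (fallingSeries x ⊛ fallingSeries y) m * ((x + y) - ι m * lam)
      deriv-fallingProduct x y m = begin
        deriv (Fx ⊛ Fy) m
          ≈⟨ deriv-⊛ Fx Fy m ⟩
        (deriv Fx ⊛ Fy) m + (Fx ⊛ deriv Fy) m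
          ≈⟨ +-cong (sum-cong (suc m) (λ k → *-congʳ (deriv-fallingSeries x k)))
                    (sum-cong (suc m) (λ k → *-congˡ (deriv-fallingSeries y (m ∸ k)))) ⟩
        sumTo (suc m) (λ k → Fx k * (x - ι k * lam) * Fy (m ∸ k))
          + sumTo (suc m) (λ k → Fx k * (Fy (m ∸ k) * (y - ι (m ∸ k) * lam)))
          ≈⟨ sym (sum-+ (suc m) _ _) ⟩
        sumTo (suc m) (λ k → Fx k * (x - ι k * lam) * Fy (m ∸ k) + Fx k * (Fy (m ∸ k) * (y - ι (m ∸ k) * lam)))
          ≈⟨ sum-cong< (suc m) combine ⟩
        sumTo (suc m) (λ k → Fx k * Fy (m ∸ k) * ((x + y) - ι m * lam))
          ≈⟨ sym (sum-*ʳ (suc m) _ _) ⟩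
        (Fx ⊛ Fy) m * ((x + y) - ι m * lam) ∎
        where
        Fx : Series
        Fx = fallingSeries x
        Fy : Series
        Fy = fallingSeries y
        combine : ∀ k → k < suc m →
          Fx k * (x - ι k * lam) * Fy (m ∸ k) + Fx k * (Fy (m ∸ k) * (y - ι (m ∸ k) * lam))
            ≈ Fx k * Fy (m ∸ k) * ((x + y) - ι m * lam)
        combine k (s≤s k≤m) =
          trans (solve 7 (λ a X b Y i j l → a :* (X :- i :* l) :* b :+ a :* (b :* (Y :- j :* l))
                                          := a :* b :* ((X :+ Y) :- (i :+ j) :* l)) refl _ _ _ _ _ _ _)
                (*-congˡ (+-congˡ (-‿cong (*-congʳ (sym (ι-split k≤m))))))

      degenerate-vandermonde : ∀ x y → (fallingSeries x ⊛ fallingSeries y) ≋ fallingSeries (x + y)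
      degenerate-vandermonde x y zero = trans (+-identityˡ _) (*-cong (*-identityˡ _) (*-identityˡ _))
      degenerate-vandermonde x y (suc m) = begin
        V (suc m)                               ≈⟨ sym (trans (*-congʳ (inv-specʳ m)) (*-identityˡ _)) ⟩
        (inv m * ι (suc m)) * V (suc m)         ≈⟨ *-assoc _ _ _ ⟩
        inv m * deriv V m                       ≈⟨ *-congˡ (deriv-fallingProduct x y m) ⟩
        inv m * (V m * z)                       ≈⟨ *-congˡ (*-congʳ (degenerate-vandermonde x y m)) ⟩
        inv m * (fallingSeries (x + y) m * z)
          ≈⟨ solve 4 (λ v f i w → v :* ((f :* i) :* w) := f :* w :* (i :* v)) refl _ _ _ _ ⟩
        fallingSeries (x + y) (suc m)           ∎
        where
        V : Series
        V = fallingSeries x ⊛ fallingSeries y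
        z : Carrier
        z = (x + y) - ι m * lam

      E-+ : ∀ x y → Eλ lam (x + y) ≋ (Eλ lam x ⊛ Eλ lam y)
      E-+ x y = ≋-trans (substLog-cong (λ m → sym (degenerate-vandermonde x y m)))
                        (substLog-⊛ (fallingSeries x) (fallingSeries y))

      alternatingE : ℕ → Series
      alternatingE d m = sumTo d (λ a → sgn a * Eλ lam (ι a) m)

      -- (1 + E_1) E_a = E_a + E_{a+1}, so the alternating sum telescopes:
      -- (1 + E_1) Σ_{a<d} (-1)^a E_a = E_0 - (-1)^d E_d
      telescoping : ∀ d m →
        ((oneS ⊕ Eλ lam 1#) ⊛ alternatingE d) m ≈ Eλ lam (ι 0) m - sgn d * Eλ lam (ι d) m
      telescoping zero m = trans (sum-zero (suc m) (λ _ _ → zeroʳ _))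
          (sym (trans (+-congˡ (-‿cong (*-identityˡ _))) (-‿inverseʳ _)))
      telescoping (suc d) m = begin
        (f₁ ⊛ (alternatingE d ⊕ scaleS (sgn d) (Eλ lam (ι d)))) m
          ≈⟨ ⊛-distribˡ (alternatingE d) (scaleS (sgn d) (Eλ lam (ι d))) f₁ m ⟩
        (f₁ ⊛ alternatingE d) m + (f₁ ⊛ scaleS (sgn d) (Eλ lam (ι d))) m
          ≈⟨ +-cong (telescoping d m) (⊛-scaleʳ (sgn d) f₁ (Eλ lam (ι d)) m) ⟩
        (Eλ lam (ι 0) m - sgn d * Eλ lam (ι d) m) + sgn d * (f₁ ⊛ Eλ lam (ι d)) m
          ≈⟨ +-congˡ (*-congˡ nextTerm) ⟩
        (Eλ lam (ι 0) m - sgn d * Eλ lam (ι d) m) + sgn d * (Eλ lam (ι d) m + Eλ lam (ι (suc d)) m)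
          ≈⟨ solve 4 (λ a s b c → (a :- s :* b) :+ s :* (b :+ c) := a :- (:- s) :* c) refl _ _ _ _ ⟩
        Eλ lam (ι 0) m - sgn (suc d) * Eλ lam (ι (suc d)) m ∎
        where
        f₁ : Series
        f₁ = oneS ⊕ Eλ lam 1#
        nextTerm : (f₁ ⊛ Eλ lam (ι d)) m ≈ Eλ lam (ι d) m + Eλ lam (ι (suc d)) m
        nextTerm = begin
          (f₁ ⊛ Eλ lam (ι d)) m
            ≈⟨ ⊛-distribʳ oneS (Eλ lam 1#) (Eλ lam (ι d)) m ⟩
          (oneS ⊛ Eλ lam (ι d)) m + (Eλ lam 1# ⊛ Eλ lam (ι d)) m
            ≈⟨ +-cong (⊛-identityˡ (Eλ lam (ι d)) m) (sym (E-+ 1# (ι d) m)) ⟩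
          Eλ lam (ι d) m + Eλ lam (ι (suc d)) m ∎

      -- For odd d:  2E_d/(1+E_1) + 2E_0/(1+E_1) = 2 Σ_{a<d} (-1)^a E_a,
      -- because E_d + E_0 = (1+E_1) Σ_{a<d} (-1)^a E_a by telescoping.
      generating-identity : ∀ k m → let d = suc (2 ℕ.* k) in
        ChGen lam (ι d) m + ChGen lam 0# m ≈ (1# + 1#) * alternatingE d m
      generating-identity k m = begin
        ChGen lam (ι d) m + ChGen lam 0# m
          ≈⟨ +-cong (⊛-scaleˡ two (Eλ lam (ι d)) G m) (⊛-scaleˡ two (Eλ lam 0#) G m) ⟩
        two * (Eλ lam (ι d) ⊛ G) m + two * (Eλ lam 0# ⊛ G) m
          ≈⟨ sym (trans (*-congˡ (⊛-distribʳ (Eλ lam (ι d)) (Eλ lam 0#) G m)) (distribˡ _ _ _)) ⟩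
        two * ((Eλ lam (ι d) ⊕ Eλ lam 0#) ⊛ G) m
          ≈⟨ *-congˡ (⊛-cong {g = G} numerator ≋-refl m) ⟩
        two * ((alternatingE d ⊛ f₁) ⊛ G) m
          ≈⟨ *-congˡ (⊛-assoc (alternatingE d) f₁ G m) ⟩
        two * (alternatingE d ⊛ (f₁ ⊛ G)) m
          ≈⟨ *-congˡ (⊛-cong {f = alternatingE d} ≋-refl (⊛-inverse f₁ (inv 1) f₁-constant) m) ⟩
        two * (alternatingE d ⊛ oneS) m
          ≈⟨ *-congˡ (⊛-identityʳ (alternatingE d) m) ⟩
        two * alternatingE d m ∎
        where
        d : ℕ
        d = suc (2 ℕ.* k)
        two : Carrier
        two = 1# + 1#
        f₁ : Series
        f₁ = oneS ⊕ Eλ lam 1#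
        G : Series
        G = invS f₁ (inv 1)
        -- the constant term of 1 + E_1 is 2
        f₁-constant : inv 1 * f₁ 0 ≈ 1#
        f₁-constant = trans (*-comm _ _) (trans (*-congʳ two≈ι2) (inv-spec 1))
          where
          two≈ι2 : f₁ 0 ≈ ι 2
          two≈ι2 = +-congˡ (trans (+-identityˡ _) (trans (*-identityʳ _) (trans (*-identityˡ _) (sym (+-identityʳ _)))))
        numerator : (Eλ lam (ι d) ⊕ Eλ lam 0#) ≋ (alternatingE d ⊛ f₁)
        numerator j = begin
          Eλ lam (ι d) j + Eλ lam 0# j                ≈⟨ +-comm _ _ ⟩
          Eλ lam (ι 0) j + Eλ lam (ι d) j             ≈⟨ +-congˡ (sym oddSign) ⟩
          Eλ lam (ι 0) j - sgn d * Eλ lam (ι d) j     ≈⟨ sym (telescoping d j) ⟩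
          (f₁ ⊛ alternatingE d) j                     ≈⟨ ⊛-comm f₁ (alternatingE d) j ⟩
          (alternatingE d ⊛ f₁) j                     ∎
          where
          oddSign : - (sgn d * Eλ lam (ι d) j) ≈ Eλ lam (ι d) j
          oddSign = begin
            - (sgn d * Eλ lam (ι d) j)     ≈⟨ -‿cong (*-congʳ (sgn-odd k)) ⟩
            - (- 1# * Eλ lam (ι d) j)      ≈⟨ -‿cong (sym (-‿distribˡ-* _ _)) ⟩
            - - (1# * Eλ lam (ι d) j)      ≈⟨ -‿involutive _ ⟩
            1# * Eλ lam (ι d) j            ≈⟨ *-identityˡ _ ⟩
            Eλ lam (ι d) j                 ∎

      stirling-expansion : ∀ n a →
        ι (n NB.!) * (sgn a * Eλ lam (ι a) n)
          ≈ sumTo (suc n) (λ m → fallingλ lam (ι a) m * ιℤ (S1 n m) * sgn a)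
      stirling-expansion n a = begin
        ι (n NB.!) * (sgn a * Eλ lam (ι a) n)
          ≈⟨ *-congˡ (sum-*ˡ (suc n) _ _) ⟩
        ι (n NB.!) * sumTo (suc n) (λ m → sgn a * (fallingλ lam (ι a) m * invFact m * logPow m n))
          ≈⟨ sum-*ˡ (suc n) _ _ ⟩
        sumTo (suc n) (λ m → ι (n NB.!) * (sgn a * (fallingλ lam (ι a) m * invFact m * logPow m n)))
          ≈⟨ sum-cong (suc n) (λ m → trans
               (solve 5 (λ A s f i p → A :* (s :* (f :* i :* p)) := f :* (A :* (i :* p)) :* s) refl _ _ _ _ _)
               (*-congʳ (*-congˡ (stirling-coefficient n m)))) ⟩
        sumTo (suc n) (λ m → fallingλ lam (ι a) m * ιℤ (S1 n m) * sgn a) ∎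

theorem2p8 : ∀ {c ℓ} (R : CommutativeRing c ℓ) (inv : ℕ → CommutativeRing.Carrier R) →
    let open CommutativeRing R
        open QAlg R inv
    in (∀ k → ι (suc k) * inv k ≈ 1#) →
       (lam : Carrier) → ¬ (lam ≈ 0#) →
       (n k : ℕ) → let d = suc (2 ℕ.* k) in
       Ch lam n (ι d) + Ch lam n 0# ≈
         (1# + 1#) * sumTo d (λ a → sumTo (suc n) (λ m →
            fallingλ lam (ι a) m * ιℤ (S1 n m) * sgn a))
theorem2p8 R inv inv-spec lam _ n k = begin
  n! * ChGen lam (ι d) n + n! * ChGen lam 0# n    ≈⟨ sym (distribˡ _ _ _) ⟩
  n! * (ChGen lam (ι d) n + ChGen lam 0# n)       ≈⟨ *-congˡ (generating-identity k n) ⟩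
  n! * (two * alternatingE d n)                   ≈⟨ sym (*-assoc _ _ _) ⟩
  (n! * two) * alternatingE d n                   ≈⟨ *-congʳ (*-comm _ _) ⟩
  (two * n!) * alternatingE d n                   ≈⟨ *-assoc _ _ _ ⟩
  two * (n! * alternatingE d n)                   ≈⟨ *-congˡ (sum-*ˡ d _ _) ⟩
  two * sumTo d (λ a → n! * (sgn a * Eλ lam (ι a) n))
    ≈⟨ *-congˡ (sum-cong d (stirling-expansion n)) ⟩
  two * sumTo d (λ a → sumTo (suc n) (λ m → fallingλ lam (ι a) m * ιℤ (S1 n m) * sgn a)) ∎
  where
  open CommutativeRing R
  open QAlg R inv
  open import Relation.Binary.Reasoning.Setoid setoid
  open Changhee R inv using (sum-*ˡ; sum-cong)
  open Changhee.WithInverses R inv inv-spec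
  open WithParameter lam
  d : ℕ
  d = suc (2 ℕ.* k)
  two : Carrier
  two = 1# + 1#
  n! : Carrier
  n! = ι (n NB.!)
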